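{- Let $T,S,S'\subseteq\mathbb{Z}_{>0}$ be finite with $S'\subseteq S$. Then $T\triangleleft S'\subseteq T\triangleleft S$.
   Context: For finite $T,S\subseteq\mathbb{Z}_{>0}$, $T\triangleleft S$ is computed by going through $s\in S$ from largest to smallest; each $s$ picks the largest not-yet-picked $t\in T$ with $t<s$, if one exists; $T\triangleleft S$ is the set of picked elements. -}

module Defs where

open import Data.Nat using (ℕ; zero; suc; _<?_; _⊔_; _≟_)
open import Data.List using (List; []; _∷_; foldr; filter)
open import Data.Maybe using (Maybe; just; nothing)
open import Relation.Nullary using (yes; no; ¬_)
open import Relation.Nullary.Decidable using (¬?)
open import Data.List.Membership.DecPropositional _≟_ using (_∈?_)

-- Finite subsets of ℤ_{>0} are represented by lists of naturals (membership
-- via Data.List.Membership.Propositional._∈_); all definitions below depend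
-- only on the membership relation of the lists, so duplicates/order are irrelevant.

largestBelow : ℕ → List ℕ → Maybe ℕ
largestBelow s [] = nothing
largestBelow s (x ∷ xs) with x <? s | largestBelow s xs
... | no _  | r       = r
... | yes _ | nothing = just x
... | yes _ | just y  = just (x ⊔ y)

remove : ℕ → List ℕ → List ℕ
remove t = filter (λ x → ¬? (x ≟ t))

process : ℕ → List ℕ → List ℕ → List ℕ
process zero    S R = []
process (suc n) S R with suc n ∈? S
... | no _  = process n S R
... | yes _ with largestBelow (suc n) R
...   | nothing = process n S R
...   | just t  = t ∷ process n S (remove t R)

maxList : List ℕ → ℕ
maxList = foldr _⊔_ 0

-- T ◁ S : go through s ∈ S from largest to smallest; each s picks the largest
-- not-yet-picked t ∈ T with t < s (if any); result = set of picked elements.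
_◁_ : List ℕ → List ℕ → List ℕ
T ◁ S = process (maxList S) S T

-- Run the process for S and for S′ ⊆ S side by side, with pools R ⊆ R′ of
-- unpicked elements; invariant: every element of R picked under S′ from R′ is
-- also picked under S from R.  An s in S only shrinks R, and when s lies in both
-- sets the larger pool R′ picks some b at least as large as the choice a from R,
-- so b ∈ R forces b = a.  Either way the pools stay nested.
module Submission where

open import Defs
open import Data.Nat using (ℕ; zero; suc; _<_; _≮_; _≤_; _≤′_; ≤′-refl; ≤′-step; s≤s; z≤n; _⊔_; _≟_; _<?_)
open import Data.Nat.Properties
  using (≤-refl; ≤-antisym; <⇒≱; ≤′⇒≤; ≤⇒≤′; ⊔-sel; ⊔-lub; ⊔-pres-<m; m≤m⊔n; m≤n⇒m≤o⊔n)
open import Data.List using (List; []; _∷_)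
open import Data.List.Relation.Unary.All using (All)
open import Data.List.Relation.Unary.Any using (here; there)
open import Data.List.Membership.Propositional using (_∈_; _∉_)
open import Data.List.Membership.Propositional.Properties using (∈-filter⁺; ∈-filter⁻)
open import Data.List.Membership.DecPropositional _≟_ using (_∈?_)
open import Data.List.Relation.Binary.Subset.Propositional using (_⊆_)
open import Data.Maybe using (Maybe; just; nothing)
open import Data.Product using (proj₁; proj₂)
open import Data.Sum using ([_,_]′)
open import Function using (_∘_; id)
open import Relation.Nullary using (yes; no; ¬_; contradiction)
open import Relation.Nullary.Decidable using (¬?)
open import Relation.Binary.PropositionalEquality using (_≡_; refl; sym; subst)

⊔-closed : (P : ℕ → Set) {m n : ℕ} → P m → P n → P (m ⊔ n)
⊔-closed P {m} {n} pm pn =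
  [ (λ eq → subst P (sym eq) pm) , (λ eq → subst P (sym eq) pn) ]′ (⊔-sel m n)

data LargestBelow (s : ℕ) (R : List ℕ) : Maybe ℕ → Set where
  none : (∀ {y} → y ∈ R → y ≮ s) → LargestBelow s R nothing
  some : ∀ {a} → a ∈ R → a < s → (∀ {y} → y ∈ R → y < s → y ≤ a) →
         LargestBelow s R (just a)

largestBelow-spec : ∀ s R → LargestBelow s R (largestBelow s R)
largestBelow-spec s [] = none (λ ())
largestBelow-spec s (x ∷ xs) with x <? s | largestBelow s xs | largestBelow-spec s xs
... | no x≮s | _ | none xs≮s = none λ { (here refl) → x≮s ; (there y∈xs) → xs≮s y∈xs }
... | no x≮s | _ | some a∈xs a<s xs≤a =
  some (there a∈xs) a<s λ { (here refl) x<s → contradiction x<s x≮s ; (there y∈xs) → xs≤a y∈xs }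
... | yes x<s | _ | none xs≮s =
  some (here refl) x<s λ { (here refl) _ → ≤-refl ; (there y∈xs) y<s → contradiction y<s (xs≮s y∈xs) }
... | yes x<s | _ | some {a} a∈xs a<s xs≤a =
  some (⊔-closed (_∈ x ∷ xs) (here refl) (there a∈xs)) (⊔-pres-<m x<s a<s)
       λ { (here refl) _ → m≤m⊔n x a ; (there y∈xs) y<s → m≤n⇒m≤o⊔n x (xs≤a y∈xs y<s) }

largestBelow-⊆ : ∀ {s R R′ a b} → R ⊆ R′ → LargestBelow s R (just a) → LargestBelow s R′ (just b) →
                 b ∈ R → b ≡ a
largestBelow-⊆ R⊆R′ (some a∈R a<s R≤a) (some _ b<s R′≤b) b∈R =
  ≤-antisym (R≤a b∈R b<s) (R′≤b (R⊆R′ a∈R) a<s)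

∈-remove⁺ : ∀ {x t R} → x ∈ R → ¬ x ≡ t → x ∈ remove t R
∈-remove⁺ {t = t} = ∈-filter⁺ (λ x → ¬? (x ≟ t))

∈-remove⁻ : ∀ {x t R} → x ∈ remove t R → x ∈ R
∈-remove⁻ {t = t} {R} = proj₁ ∘ ∈-filter⁻ (λ x → ¬? (x ≟ t)) {xs = R}

∉-remove : ∀ {t R} → t ∉ remove t R
∉-remove {t} {R} t∈ = proj₂ (∈-filter⁻ (λ x → ¬? (x ≟ t)) {xs = R} t∈) refl

remove-⊆ : ∀ {t R R′} → R ⊆ R′ → t ∉ R → R ⊆ remove t R′
remove-⊆ R⊆R′ t∉R y∈R = ∈-remove⁺ (R⊆R′ y∈R) λ { refl → t∉R y∈R }

∈-∷-remove : ∀ {x a R ys} → x ∈ R → (x ∈ remove a R → x ∈ ys) → x ∈ a ∷ ys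
∈-∷-remove {x} {a} x∈R f with x ≟ a
... | yes x≡a = here x≡a
... | no x≢a = there (f (∈-remove⁺ x∈R x≢a))

process-⊆ : ∀ n S R → process n S R ⊆ R
process-⊆ zero _ _ ()
process-⊆ (suc n) S R x∈ with suc n ∈? S
... | no _ = process-⊆ n S R x∈
... | yes _ with largestBelow (suc n) R | largestBelow-spec (suc n) R
...   | nothing | _ = process-⊆ n S R x∈
...   | just t | some t∈R _ _ with x∈
...     | here refl = t∈R
...     | there x∈′ = ∈-remove⁻ (process-⊆ n S (remove t R) x∈′)

process-mono : ∀ n {S S′ R R′} → S′ ⊆ S → R ⊆ R′ →
               ∀ {x} → x ∈ process n S′ R′ → x ∈ R → x ∈ process n S R
process-mono zero _ _ () _
process-mono (suc n) {S} {S′} {R} S′⊆S R⊆R′ x∈ x∈R with suc n ∈? S | suc n ∈? S′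
... | no s∉S | yes s∈S′ = contradiction (S′⊆S s∈S′) s∉S
... | no _ | no _ = process-mono n S′⊆S R⊆R′ x∈ x∈R
... | yes _ | no _ with largestBelow (suc n) R
...   | nothing = process-mono n S′⊆S R⊆R′ x∈ x∈R
...   | just a = ∈-∷-remove x∈R (process-mono n S′⊆S (R⊆R′ ∘ ∈-remove⁻) x∈)
process-mono (suc n) {R = R} {R′} S′⊆S R⊆R′ x∈ x∈R | yes _ | yes _
  with largestBelow (suc n) R  | largestBelow-spec (suc n) R
     | largestBelow (suc n) R′ | largestBelow-spec (suc n) R′
... | nothing | _ | nothing | _ = process-mono n S′⊆S R⊆R′ x∈ x∈R
... | just a | some a∈R a<s _ | nothing | none R′≮s = contradiction a<s (R′≮s (R⊆R′ a∈R))
... | nothing | none R≮s | just b | some _ b<s _ with x∈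
...   | here refl = contradiction b<s (R≮s x∈R)
...   | there x∈′ = process-mono n S′⊆S (remove-⊆ R⊆R′ λ b∈R → R≮s b∈R b<s) x∈′ x∈R
process-mono (suc n) {R = R} S′⊆S R⊆R′ x∈ x∈R | yes _ | yes _
  | just a | pick | just b | pick′ with x∈
... | here refl = here (largestBelow-⊆ R⊆R′ pick pick′ x∈R)
... | there x∈′ = ∈-∷-remove x∈R (process-mono n S′⊆S (remove-⊆ (R⊆R′ ∘ ∈-remove⁻) b∉R∖a) x∈′)
  where
  b∉R∖a : b ∉ remove a R
  b∉R∖a b∈R∖a = ∉-remove {R = R} (subst (_∈ remove a R) b≡a b∈R∖a)
    where
    b≡a : b ≡ a
    b≡a = largestBelow-⊆ R⊆R′ pick pick′ (∈-remove⁻ {R = R} b∈R∖a)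

≤-maxList : ∀ {s} S → s ∈ S → s ≤ maxList S
≤-maxList (x ∷ S) (here refl) = m≤m⊔n x (maxList S)
≤-maxList (x ∷ S) (there s∈S) = m≤n⇒m≤o⊔n x (≤-maxList S s∈S)

maxList-lub : ∀ {m} S → (∀ {s} → s ∈ S → s ≤ m) → maxList S ≤ m
maxList-lub [] _ = z≤n
maxList-lub (x ∷ S) S≤m = ⊔-lub (S≤m (here refl)) (maxList-lub S (S≤m ∘ there))

process-beyond-bound : ∀ {m n S R} → (∀ {s} → s ∈ S → s ≤ m) → m ≤′ n →
                       process n S R ≡ process m S R
process-beyond-bound S≤m ≤′-refl = refl
process-beyond-bound {n = suc n} {S} S≤m (≤′-step m≤′n) with suc n ∈? S
... | yes n+1∈S = contradiction (S≤m n+1∈S) (<⇒≱ (s≤s (≤′⇒≤ m≤′n)))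
... | no _ = process-beyond-bound S≤m m≤′n

lemma4p14 : (T S S′ : List ℕ) →
              All (0 <_) T → All (0 <_) S → All (0 <_) S′ →
              (∀ {x} → x ∈ S′ → x ∈ S) →
              ∀ {x} → x ∈ T ◁ S′ → x ∈ T ◁ S
lemma4p14 T S S′ _ _ _ S′⊆S {x} x∈T◁S′ =
  process-mono (maxList S) S′⊆S id x∈process (process-⊆ (maxList S′) S′ T x∈T◁S′)
  where
  maxS′≤maxS : maxList S′ ≤ maxList S
  maxS′≤maxS = maxList-lub S′ (≤-maxList S ∘ S′⊆S)

  x∈process : x ∈ process (maxList S) S′ T
  x∈process = subst (x ∈_) (sym (process-beyond-bound (≤-maxList S′) (≤⇒≤′ maxS′≤maxS))) x∈T◁S′
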